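{- Let $q$ be any prime power, let $K=GF(q)$ and $F=GF(q^3)$ (so $K$ is a subfield of $F$), let $\xi$ be any primitive element of $F$ (a generator of the cyclic group $F^*$), and let $G=F^*/K^*$. Let $S=\{\xi K^*\}\cup\{(1+t\xi)K^*:\ t\in K\}\subseteq G$. Define the graph $\mathrm{Diff}(q)$ with vertex set $G$, in which two distinct vertices $gK^*,hK^*$ are adjacent if and only if $(gK^*)(hK^*)=ghK^*\in S$. Define the Brown graph $B(q)$ whose vertices are the points of the projective plane $PG(2,q)$, i.e. nonzero vectors $\overline{x}=(x_0,x_1,x_2)\in K^3$ up to nonzero scalar multiples, in which two distinct vertices represented by $\overline{x},\overline{y}$ are adjacent if and only if $x_0y_0+x_1y_1+x_2y_2=0$. Then $\mathrm{Diff}(q)$ and $B(q)$ are isomorphic graphs.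
   Context: Loops are suppressed in both graphs: a vertex is never adjacent to itself. The set $S$ is a perfect difference set in the cyclic group $G$ of order $q^2+q+1$. -}

module Defs where

open import Level using (Level; _⊔_)
open import Algebra.Bundles using (CommutativeRing)
open import Data.Nat using (ℕ; zero; suc; _^_)
open import Data.Nat.Primality using (Prime)
open import Data.Fin using (Fin)
open import Data.Product using (Σ; proj₁; ∃; ∃-syntax; _×_; _,_)
open import Data.Sum using (_⊎_)
open import Relation.Nullary using (¬_)
open import Relation.Binary.PropositionalEquality using (_≡_)
open import Function.Bundles using (_⇔_)

IsPrimePower : ℕ → Set
IsPrimePower q = ∃[ p ] ∃[ k ] (Prime p × q ≡ p ^ suc k)

module _ {c ℓ : Level} (R : CommutativeRing c ℓ) where
  open CommutativeRing R

  record IsField : Set (c ⊔ ℓ) where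
    field
      0≉1 : ¬ (0# ≈ 1#)
      inverse : ∀ x → ¬ (x ≈ 0#) → ∃[ y ] (x * y ≈ 1#)

  record HasCardinality (n : ℕ) : Set (c ⊔ ℓ) where
    field
      enum : Fin n → Carrier
      enum-injective : ∀ i j → enum i ≈ enum j → i ≡ j
      enum-surjective : ∀ x → ∃[ i ] (enum i ≈ x)

  pow : Carrier → ℕ → Carrier
  pow x zero = 1#
  pow x (suc n) = x * pow x n

  NonZero : Set (c ⊔ ℓ)
  NonZero = Σ Carrier (λ x → ¬ (x ≈ 0#))

  IsPrimitive : Carrier → Set (c ⊔ ℓ)
  IsPrimitive ξ = ¬ (ξ ≈ 0#) × (∀ x → ¬ (x ≈ 0#) → ∃[ n ] (pow ξ n ≈ x))

record IsFieldEmbedding {c₁ ℓ₁ c₂ ℓ₂ : Level}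
    (K : CommutativeRing c₁ ℓ₁) (F : CommutativeRing c₂ ℓ₂)
    (ι : CommutativeRing.Carrier K → CommutativeRing.Carrier F) : Set (c₁ ⊔ ℓ₁ ⊔ ℓ₂) where
  private
    module K = CommutativeRing K
    module F = CommutativeRing F
  field
    ι-cong : ∀ {a b} → a K.≈ b → ι a F.≈ ι b
    ι-+ : ∀ a b → ι (a K.+ b) F.≈ ι a F.+ ι b
    ι-* : ∀ a b → ι (a K.* b) F.≈ ι a F.* ι b
    ι-1 : ι K.1# F.≈ F.1#

-- Graphs on a type of vertex representatives considered up to an equivalence ~
-- (vertices are ~-classes); adjacency is a relation on representatives.
record QuotGraphIso {a b r s e f : Level}
    (V : Set a) (_~V_ : V → V → Set r) (AdjV : V → V → Set e)
    (W : Set b) (_~W_ : W → W → Set s) (AdjW : W → W → Set f)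
    : Set (a ⊔ b ⊔ r ⊔ s ⊔ e ⊔ f) where
  field
    φ : V → W
    φ-cong : ∀ {x y} → x ~V y → φ x ~W φ y
    φ-injective : ∀ {x y} → φ x ~W φ y → x ~V y
    φ-surjective : ∀ w → ∃[ v ] (φ v ~W w)
    φ-adj : ∀ x y → AdjV x y ⇔ AdjW (φ x) (φ y)

module Construction {c₁ ℓ₁ c₂ ℓ₂ : Level}
    (K : CommutativeRing c₁ ℓ₁) (F : CommutativeRing c₂ ℓ₂)
    (ι : CommutativeRing.Carrier K → CommutativeRing.Carrier F)
    (ξ : CommutativeRing.Carrier F) where
  private
    module K = CommutativeRing K
    module F = CommutativeRing F

  GVert : Set (c₂ ⊔ ℓ₂)
  GVert = NonZero F

  -- x K* = y K*  iff  y = ι t · x for some t ∈ K (t is then automatically nonzero)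
  _~G_ : GVert → GVert → Set (c₁ ⊔ ℓ₂)
  (x , _) ~G (y , _) = ∃[ t ] (y F.≈ ι t F.* x)

  InS : F.Carrier → Set (c₁ ⊔ ℓ₂)
  InS x = (∃[ t ] (x F.≈ ι t F.* ξ)) ⊎ (∃[ t ] ∃[ u ] (x F.≈ ι u F.* (F.1# F.+ ι t F.* ξ)))

  DiffAdj : GVert → GVert → Set (c₁ ⊔ ℓ₂)
  DiffAdj g h = ¬ (g ~G h) × InS (proj₁ g F.* proj₁ h)

  Vec3 : Set c₁
  Vec3 = K.Carrier × K.Carrier × K.Carrier

  isZero3 : Vec3 → Set ℓ₁
  isZero3 (x₀ , x₁ , x₂) = x₀ K.≈ K.0# × x₁ K.≈ K.0# × x₂ K.≈ K.0#

  PVert : Set (c₁ ⊔ ℓ₁)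
  PVert = Σ Vec3 (λ v → ¬ isZero3 v)

  _~P_ : PVert → PVert → Set (c₁ ⊔ ℓ₁)
  ((x₀ , x₁ , x₂) , _) ~P ((y₀ , y₁ , y₂) , _) =
    ∃[ λ' ] (y₀ K.≈ λ' K.* x₀ × y₁ K.≈ λ' K.* x₁ × y₂ K.≈ λ' K.* x₂)

  dot : Vec3 → Vec3 → K.Carrier
  dot (x₀ , x₁ , x₂) (y₀ , y₁ , y₂) = x₀ K.* y₀ K.+ x₁ K.* y₁ K.+ x₂ K.* y₂

  BrownAdj : PVert → PVert → Set (c₁ ⊔ ℓ₁)
  BrownAdj x y = ¬ (x ~P y) × dot (proj₁ x) (proj₁ y) K.≈ K.0#

{-# OPTIONS --safe #-}
-- Identify F = GF(q³) with K³ through the basis 1, ξ, ξ², which is a basis because ξ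
-- generates F* while the span of 1 and ξ has only q² elements. The cosets in S are then
-- exactly the cosets xK* whose ξ²-coordinate λ(x) vanishes, so gK* and hK* are adjacent
-- in Diff(q) iff λ(gh) = 0. Now (x, y) ↦ λ(xy) is a symmetric bilinear form on K³, and
-- over a finite field it has an orthogonal basis of vectors of one common nonzero norm k
-- (built from a solution of a² + b² + 1 = 0 in odd characteristic, and from a square root
-- in characteristic 2). In these coordinates λ(xy) = k (x · y), so the coordinate map
-- carries Diff(q) onto the Brown graph, cosets of K* going to projective points.
module Submission where

open import Defs
open import Level using (Level; _⊔_; 0ℓ)
open import Algebra.Bundles using (CommutativeRing)
open import Algebra.Bundles.Raw using (RawRing)
open import Data.Nat as ℕ using (ℕ; zero; suc; _^_)
import Data.Nat.Properties as ℕₚ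
open import Data.Integer as ℤ using (ℤ; +_; -[1+_]; sign; ∣_∣; _◃_)
import Data.Integer.Properties as ℤₚ
open import Data.Sign as Sign using (Sign)
open import Data.Fin as Fin using (Fin; punchOut; remQuot; combine)
import Data.Fin.Properties as Finₚ
open import Data.Maybe using (Maybe; just; nothing)
open import Data.Product using (∃; ∃-syntax; _×_; _,_; proj₁; proj₂)
open import Data.Product.Relation.Binary.Pointwise.NonDependent using (_×ₛ_)
open import Data.Sum as Sum using (_⊎_; inj₁; inj₂; [_,_]′)
open import Data.Empty using (⊥; ⊥-elim)
open import Function using (id)
open import Relation.Nullary using (¬_; Dec; yes; no)
open import Relation.Binary.PropositionalEquality as ≡ using (_≡_; _≢_)
open import Relation.Binary.Bundles using (Setoid)

-- The reflective solver of the library takes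
-- the ring itself as coefficients, which do not compute in an abstract ring, so it
-- cannot cancel x - x or identify 1# + 1# with 2.
module IntegerCoefficients {c ℓ} (R : CommutativeRing c ℓ) where
  open CommutativeRing R
  open import Relation.Binary.Reasoning.Setoid setoid
  open import Algebra.Definitions.RawMonoid +-rawMonoid using (_×′_)
  open import Algebra.Properties.Monoid.Mult.TCOptimised +-monoid using (×-homo-+)
  open import Algebra.Properties.Semiring.Mult.TCOptimised semiring using (×1-homo-*)
  open import Algebra.Properties.Ring ring using (-‿distribˡ-*; -‿distribʳ-*; -‿involutive; -0#≈0#; -‿anti-homo-+)
  open import Algebra.Solver.Ring.AlmostCommutativeRing using (fromCommutativeRing; _-Raw-AlmostCommutative⟶_)

  -- With _×′_, ⟦ 1 ⟧ℕ is 1# and ⟦ 2 ⟧ℕ is 1# + 1# definitionally, which is how constants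
  -- appear in the goals.
  ⟦_⟧ℕ : ℕ → Carrier
  ⟦ n ⟧ℕ = n ×′ 1#

  ⟦_⟧ℤ : ℤ → Carrier
  ⟦ + n ⟧ℤ = ⟦ n ⟧ℕ
  ⟦ -[1+ n ] ⟧ℤ = - ⟦ suc n ⟧ℕ

  private
    signed : Sign → Carrier → Carrier
    signed Sign.+ x = x
    signed Sign.- x = - x

    signed-cong : ∀ s {x y} → x ≈ y → signed s x ≈ signed s y
    signed-cong Sign.+ x≈y = x≈y
    signed-cong Sign.- x≈y = -‿cong x≈y

    signed-* : ∀ s t x y → signed (s Sign.* t) (x * y) ≈ signed s x * signed t y
    signed-* Sign.+ Sign.+ x y = refl
    signed-* Sign.+ Sign.- x y = -‿distribʳ-* x y
    signed-* Sign.- Sign.+ x y = -‿distribˡ-* x y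
    signed-* Sign.- Sign.- x y = begin
      x * y             ≈⟨ -‿involutive (x * y) ⟨
      - - (x * y)       ≈⟨ -‿cong (-‿distribʳ-* x y) ⟩
      - (x * - y)       ≈⟨ -‿distribˡ-* x (- y) ⟩
      - x * - y         ∎

    ◃-homo : ∀ s n → ⟦ s ◃ n ⟧ℤ ≈ signed s ⟦ n ⟧ℕ
    ◃-homo Sign.+ zero = refl
    ◃-homo Sign.- zero = sym -0#≈0#
    ◃-homo Sign.+ (suc n) = refl
    ◃-homo Sign.- (suc n) = refl

    ⟦⟧ℤ-signAbs : ∀ i → ⟦ i ⟧ℤ ≈ signed (sign i) ⟦ ∣ i ∣ ⟧ℕ
    ⟦⟧ℤ-signAbs (+ n) = refl
    ⟦⟧ℤ-signAbs -[1+ n ] = refl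

    suc-minus-suc : ∀ a b → (1# + a) - (1# + b) ≈ a - b
    suc-minus-suc a b = begin
      (1# + a) - (1# + b)     ≈⟨ +-congˡ (-‿cong (+-comm 1# b)) ⟩
      (1# + a) + - (b + 1#)   ≈⟨ +-congˡ (-‿anti-homo-+ b 1#) ⟩
      (1# + a) + (- 1# - b)   ≈⟨ +-congʳ (+-comm 1# a) ⟩
      (a + 1#) + (- 1# - b)   ≈⟨ +-assoc a 1# (- 1# - b) ⟩
      a + (1# + (- 1# - b))   ≈⟨ +-congˡ (+-assoc 1# (- 1#) (- b)) ⟨
      a + ((1# - 1#) - b)     ≈⟨ +-congˡ (+-congʳ (-‿inverseʳ 1#)) ⟩
      a + (0# - b)            ≈⟨ +-congˡ (+-identityˡ (- b)) ⟩
      a - b                   ∎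

    ⊖-homo : ∀ m n → ⟦ m ℤ.⊖ n ⟧ℤ ≈ ⟦ m ⟧ℕ - ⟦ n ⟧ℕ
    ⊖-homo zero zero = sym (-‿inverseʳ 0#)
    ⊖-homo zero (suc n) = sym (+-identityˡ _)
    ⊖-homo (suc m) zero = sym (trans (+-congˡ -0#≈0#) (+-identityʳ _))
    ⊖-homo (suc m) (suc n) = begin
      ⟦ suc m ℤ.⊖ suc n ⟧ℤ              ≡⟨ ≡.cong ⟦_⟧ℤ (ℤₚ.[1+m]⊖[1+n]≡m⊖n m n) ⟩
      ⟦ m ℤ.⊖ n ⟧ℤ                      ≈⟨ ⊖-homo m n ⟩
      ⟦ m ⟧ℕ - ⟦ n ⟧ℕ                   ≈⟨ suc-minus-suc ⟦ m ⟧ℕ ⟦ n ⟧ℕ ⟨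
      (1# + ⟦ m ⟧ℕ) - (1# + ⟦ n ⟧ℕ)     ≈⟨ +-cong (×-homo-+ 1# 1 m) (-‿cong (×-homo-+ 1# 1 n)) ⟨
      ⟦ suc m ⟧ℕ - ⟦ suc n ⟧ℕ           ∎

  +-homo : ∀ i j → ⟦ i ℤ.+ j ⟧ℤ ≈ ⟦ i ⟧ℤ + ⟦ j ⟧ℤ
  +-homo -[1+ m ] -[1+ n ] = begin
    - ⟦ suc (suc (m ℕ.+ n)) ⟧ℕ        ≡⟨ ≡.cong (λ k → - ⟦ k ⟧ℕ) (ℕₚ.+-suc (suc m) n) ⟨
    - ⟦ suc m ℕ.+ suc n ⟧ℕ            ≈⟨ -‿cong (×-homo-+ 1# (suc m) (suc n)) ⟩
    - (⟦ suc m ⟧ℕ + ⟦ suc n ⟧ℕ)       ≈⟨ -‿anti-homo-+ _ _ ⟩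
    - ⟦ suc n ⟧ℕ - ⟦ suc m ⟧ℕ         ≈⟨ +-comm _ _ ⟩
    - ⟦ suc m ⟧ℕ - ⟦ suc n ⟧ℕ         ∎
  +-homo -[1+ m ] (+ n) = trans (⊖-homo n (suc m)) (+-comm _ _)
  +-homo (+ m) -[1+ n ] = ⊖-homo m (suc n)
  +-homo (+ m) (+ n) = ×-homo-+ 1# m n

  *-homo : ∀ i j → ⟦ i ℤ.* j ⟧ℤ ≈ ⟦ i ⟧ℤ * ⟦ j ⟧ℤ
  *-homo i j = begin
    ⟦ sign i Sign.* sign j ◃ ∣ i ∣ ℕ.* ∣ j ∣ ⟧ℤ               ≈⟨ ◃-homo (sign i Sign.* sign j) (∣ i ∣ ℕ.* ∣ j ∣) ⟩
    signed (sign i Sign.* sign j) ⟦ ∣ i ∣ ℕ.* ∣ j ∣ ⟧ℕ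
      ≈⟨ signed-cong (sign i Sign.* sign j) (×1-homo-* ∣ i ∣ ∣ j ∣) ⟩
    signed (sign i Sign.* sign j) (⟦ ∣ i ∣ ⟧ℕ * ⟦ ∣ j ∣ ⟧ℕ)     ≈⟨ signed-* (sign i) (sign j) _ _ ⟩
    signed (sign i) ⟦ ∣ i ∣ ⟧ℕ * signed (sign j) ⟦ ∣ j ∣ ⟧ℕ     ≈⟨ *-cong (⟦⟧ℤ-signAbs i) (⟦⟧ℤ-signAbs j) ⟨
    ⟦ i ⟧ℤ * ⟦ j ⟧ℤ                                              ∎

  -‿homo : ∀ i → ⟦ ℤ.- i ⟧ℤ ≈ - ⟦ i ⟧ℤ
  -‿homo -[1+ n ] = sym (-‿involutive _)
  -‿homo (+ zero) = sym -0#≈0#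
  -‿homo (+ suc n) = refl

  ℤ-morphism : ℤ.+-*-rawRing -Raw-AlmostCommutative⟶ fromCommutativeRing R
  ℤ-morphism = record
    { ⟦_⟧ = ⟦_⟧ℤ ; +-homo = +-homo ; *-homo = *-homo ; -‿homo = -‿homo
    ; 0-homo = refl ; 1-homo = refl }

  ⟦⟧ℤ-equal? : ∀ i j → Maybe (⟦ i ⟧ℤ ≈ ⟦ j ⟧ℤ)
  ⟦⟧ℤ-equal? i j with i ℤ.≟ j
  ... | yes i≡j = just (reflexive (≡.cong ⟦_⟧ℤ i≡j))
  ... | no _ = nothing

  open import Algebra.Solver.Ring ℤ.+-*-rawRing (fromCommutativeRing R) ℤ-morphism ⟦⟧ℤ-equal? public
    using (Polynomial; solve; _:=_; _:+_; _:*_; _:-_; :-_; con)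

  -- Lets formulas written over an arbitrary RawRing be instantiated both in R and in the
  -- solver's syntax.
  Polynomial-rawRing : ℕ → RawRing 0ℓ 0ℓ
  Polynomial-rawRing n = record
    { Carrier = Polynomial n ; _≈_ = _≡_ ; _+_ = _:+_ ; _*_ = _:*_ ; -_ = :-_
    ; 0# = con (+ 0) ; 1# = con (+ 1) }

Fin-injective⇒surjective : ∀ {n} (f : Fin n → Fin n) → (∀ {i j} → f i ≡ f j → i ≡ j) →
                           ∀ k → ∃[ i ] f i ≡ k
Fin-injective⇒surjective {suc m} f f-inj k with Finₚ.any? (λ i → f i Fin.≟ k)
... | yes hit = hit
... | no miss = ⊥-elim (Finₚ.<⇒notInjective (ℕₚ.n<1+n m) punchOut-injective)
  where
  k≢f : ∀ i → k ≢ f i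
  k≢f i k≡fi = miss (i , ≡.sym k≡fi)

  punchOut-injective : ∀ {i j} → punchOut (k≢f i) ≡ punchOut (k≢f j) → i ≡ j
  punchOut-injective eq = f-inj (Finₚ.punchOut-injective (k≢f _) (k≢f _) eq)

record Enumeration {a ℓ} (S : Setoid a ℓ) (n : ℕ) : Set (a ⊔ ℓ) where
  open Setoid S
  field
    enum : Fin n → Carrier
    enum-injective : ∀ {i j} → enum i ≈ enum j → i ≡ j
    enum-surjective : ∀ x → ∃[ i ] (enum i ≈ x)

  index : Carrier → Fin n
  index x = proj₁ (enum-surjective x)

  enum-index : ∀ x → enum (index x) ≈ x
  enum-index x = proj₂ (enum-surjective x)

  index-cong : ∀ {x y} → x ≈ y → index x ≡ index y
  index-cong {x} {y} x≈y = enum-injective (trans (enum-index x) (trans x≈y (sym (enum-index y))))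

  index-injective : ∀ {x y} → index x ≡ index y → x ≈ y
  index-injective {x} {y} eq = trans (sym (enum-index x)) (trans (reflexive (≡.cong enum eq)) (enum-index y))

  _≟_ : ∀ x y → Dec (x ≈ y)
  x ≟ y with index x Fin.≟ index y
  ... | yes eq = yes (index-injective eq)
  ... | no neq = no (λ x≈y → neq (index-cong x≈y))

  ≉⇒2≤ : ∀ {x y} → ¬ (x ≈ y) → 2 ℕ.≤ n
  ≉⇒2≤ {x} {y} x≉y = Finₚ.injective⇒≤ {f = pick} pick-injective
    where
    pick : Fin 2 → Fin n
    pick Fin.zero = index x
    pick (Fin.suc Fin.zero) = index y

    pick-injective : ∀ {i j} → pick i ≡ pick j → i ≡ j
    pick-injective {Fin.zero} {Fin.zero} _ = ≡.refl
    pick-injective {Fin.zero} {Fin.suc Fin.zero} eq = ⊥-elim (x≉y (index-injective eq))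
    pick-injective {Fin.suc Fin.zero} {Fin.zero} eq = ⊥-elim (x≉y (index-injective (≡.sym eq)))
    pick-injective {Fin.suc Fin.zero} {Fin.suc Fin.zero} _ = ≡.refl

  any? : ∀ {p} {P : Carrier → Set p} → (∀ {x y} → x ≈ y → P x → P y) → (∀ x → Dec (P x)) → Dec (∃ P)
  any? resp P? with Finₚ.any? (λ i → P? (enum i))
  ... | yes (i , Pi) = yes (enum i , Pi)
  ... | no none = no (λ (x , Px) → none (index x , resp (sym (enum-index x)) Px))

module _ {a b ℓa ℓb} {A : Setoid a ℓa} {B : Setoid b ℓb} where
  private
    module A = Setoid A
    module B = Setoid B

  injective⇒surjective : ∀ {n} → Enumeration A n → Enumeration B n → (f : A.Carrier → B.Carrier) →
    (∀ {x y} → x A.≈ y → f x B.≈ f y) → (∀ {x y} → f x B.≈ f y → x A.≈ y) →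
    ∀ y → ∃[ x ] (f x B.≈ y)
  injective⇒surjective {n} EA EB f f-cong f-injective y =
    EA.enum (proj₁ hit) , EB.index-injective (proj₂ hit)
    where
    module EA = Enumeration EA
    module EB = Enumeration EB

    g : Fin n → Fin n
    g i = EB.index (f (EA.enum i))

    hit : ∃[ i ] g i ≡ EB.index y
    hit = Fin-injective⇒surjective g (λ eq → EA.enum-injective (f-injective (EB.index-injective eq))) (EB.index y)

  surjective⇒≤ : ∀ {m n} → Enumeration A m → Enumeration B n → (f : A.Carrier → B.Carrier) →
    (∀ {x y} → x A.≈ y → f x B.≈ f y) → (∀ y → ∃[ x ] (f x B.≈ y)) → n ℕ.≤ m
  surjective⇒≤ {m} {n} EA EB f f-cong f-surj = Finₚ.injective⇒≤ section-injective
    where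
    module EA = Enumeration EA
    module EB = Enumeration EB

    section : Fin n → Fin m
    section j = EA.index (proj₁ (f-surj (EB.enum j)))

    section-injective : ∀ {i j} → section i ≡ section j → i ≡ j
    section-injective {i} {j} eq = EB.enum-injective (B.trans (B.sym (proj₂ (f-surj _)))
      (B.trans (f-cong (EA.index-injective eq)) (proj₂ (f-surj _))))

  _×-enumeration_ : ∀ {m n} → Enumeration A m → Enumeration B n → Enumeration (A ×ₛ B) (m ℕ.* n)
  _×-enumeration_ {m} {n} EA EB = record
    { enum = pair
    ; enum-injective = λ (eq₁ , eq₂) → split-injective (EA.enum-injective eq₁) (EB.enum-injective eq₂)
    ; enum-surjective = λ (x , y) → combine (EA.index x) (EB.index y) , pair-combine x y
    }
    where
    module EA = Enumeration EA
    module EB = Enumeration EB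

    split : Fin (m ℕ.* n) → Fin m × Fin n
    split = remQuot {m} n

    pair : Fin (m ℕ.* n) → A.Carrier × B.Carrier
    pair k = EA.enum (proj₁ (split k)) , EB.enum (proj₂ (split k))

    split-injective : ∀ {k l} → proj₁ (split k) ≡ proj₁ (split l) → proj₂ (split k) ≡ proj₂ (split l) → k ≡ l
    split-injective {k} {l} eq₁ eq₂ = begin
      k                                            ≡⟨ Finₚ.combine-remQuot {m} n k ⟨
      combine (proj₁ (split k)) (proj₂ (split k))  ≡⟨ ≡.cong₂ combine eq₁ eq₂ ⟩
      combine (proj₁ (split l)) (proj₂ (split l))  ≡⟨ Finₚ.combine-remQuot {m} n l ⟩
      l                                            ∎
      where open ≡.≡-Reasoning

    pair-combine : ∀ x y → Setoid._≈_ (A ×ₛ B) (pair (combine (EA.index x) (EB.index y))) (x , y)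
    pair-combine x y = ≡.subst (λ (i , j) → EA.enum i A.≈ x × EB.enum j B.≈ y)
      (≡.sym (Finₚ.remQuot-combine (EA.index x) (EB.index y))) (EA.enum-index x , EB.enum-index y)

module FiniteField {c ℓ} (R : CommutativeRing c ℓ) (R-field : IsField R) {n : ℕ}
    (R-enumeration : Enumeration (CommutativeRing.setoid R) n) where
  open CommutativeRing R
  open IsField R-field
  open Enumeration R-enumeration public using (_≟_; any?)
  open Enumeration R-enumeration using (index; index-cong; index-injective)
  open IntegerCoefficients R
  open import Relation.Binary.Reasoning.Setoid setoid
  open import Algebra.Properties.Ring ring using (-‿involutive; -0#≈0#)
  open import Algebra.Properties.Group +-group using (x∙y⁻¹≈ε⇒x≈y; x≈y⇒x∙y⁻¹≈ε)

  *-cancelˡ : ∀ {x y z} → ¬ (x ≈ 0#) → x * y ≈ x * z → y ≈ z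
  *-cancelˡ {x} {y} {z} x≉0 xy≈xz with x⁻¹ , xx⁻¹≈1 ← inverse x x≉0 = begin
    y                 ≈⟨ *-identityˡ y ⟨
    1# * y            ≈⟨ *-congʳ x⁻¹x≈1 ⟨
    (x⁻¹ * x) * y     ≈⟨ *-assoc x⁻¹ x y ⟩
    x⁻¹ * (x * y)     ≈⟨ *-congˡ xy≈xz ⟩
    x⁻¹ * (x * z)     ≈⟨ *-assoc x⁻¹ x z ⟨
    (x⁻¹ * x) * z     ≈⟨ *-congʳ x⁻¹x≈1 ⟩
    1# * z            ≈⟨ *-identityˡ z ⟩
    z                 ∎
    where x⁻¹x≈1 = trans (*-comm x⁻¹ x) xx⁻¹≈1

  x*y≈0⇒x≈0∨y≈0 : ∀ {x y} → x * y ≈ 0# → x ≈ 0# ⊎ y ≈ 0#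
  x*y≈0⇒x≈0∨y≈0 {x} {y} xy≈0 with x ≟ 0#
  ... | yes x≈0 = inj₁ x≈0
  ... | no x≉0 = inj₂ (*-cancelˡ x≉0 (trans xy≈0 (sym (zeroʳ x))))

  x≉0∧y≉0⇒x*y≉0 : ∀ {x y} → ¬ (x ≈ 0#) → ¬ (y ≈ 0#) → ¬ (x * y ≈ 0#)
  x≉0∧y≉0⇒x*y≉0 x≉0 y≉0 xy≈0 = [ x≉0 , y≉0 ]′ (x*y≈0⇒x≈0∨y≈0 xy≈0)

  x*x≈0⇒x≈0 : ∀ {x} → x * x ≈ 0# → x ≈ 0#
  x*x≈0⇒x≈0 xx≈0 = [ id , id ]′ (x*y≈0⇒x≈0∨y≈0 xx≈0)

  x-y≈0⇒x≈y : ∀ {x y} → x - y ≈ 0# → x ≈ y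
  x-y≈0⇒x≈y {x} {y} = x∙y⁻¹≈ε⇒x≈y x y

  x≈y⇒x-y≈0 : ∀ {x y} → x ≈ y → x - y ≈ 0#
  x≈y⇒x-y≈0 = x≈y⇒x∙y⁻¹≈ε

  x*x≈y*y⇒x≈±y : ∀ {x y} → x * x ≈ y * y → x ≈ y ⊎ x ≈ - y
  x*x≈y*y⇒x≈±y {x} {y} xx≈yy = Sum.map x-y≈0⇒x≈y (λ x+y≈0 → x-y≈0⇒x≈y (trans (+-congˡ (-‿involutive y)) x+y≈0))
    (x*y≈0⇒x≈0∨y≈0 (begin
      (x - y) * (x + y)   ≈⟨ solve 2 (λ x y → (x :- y) :* (x :+ y) := x :* x :- y :* y) refl x y ⟩
      x * x - y * y       ≈⟨ x≈y⇒x-y≈0 xx≈yy ⟩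
      0#                  ∎))

  private
    Canonical : Carrier → Set
    Canonical x = index x Fin.≤ index (- x)

    canonical-cong : ∀ {x y} → x ≈ y → Canonical x → Canonical y
    canonical-cong x≈y = ≡.subst₂ Fin._≤_ (index-cong x≈y) (index-cong (-‿cong x≈y))

    canonical-0 : Canonical 0#
    canonical-0 = ≡.subst (index 0# Fin.≤_) (index-cong (sym -0#≈0#)) Finₚ.≤-refl

    canonical-± : ∀ {x y} → x ≈ - y → Canonical x → Canonical y → x ≈ y
    canonical-± {x} {y} x≈-y x-canonical y-canonical = index-injective (Finₚ.≤-antisym
      (≡.subst (index x Fin.≤_) (index-cong (trans (-‿cong x≈-y) (-‿involutive y))) x-canonical)
      (≡.subst (index y Fin.≤_) (index-cong (sym x≈-y)) y-canonical))

    canonical-∓ : ∀ {x y} → x ≈ - y → Canonical x ⊎ Canonical y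
    canonical-∓ {x} {y} x≈-y with Finₚ.≤-total (index x) (index y)
    ... | inj₁ ix≤iy = inj₁ (≡.subst (index x Fin.≤_) (index-cong (sym (trans (-‿cong x≈-y) (-‿involutive y)))) ix≤iy)
    ... | inj₂ iy≤ix = inj₂ (≡.subst (index y Fin.≤_) (index-cong x≈-y) iy≤ix)

  -- If x² + y² + 1 never vanishes, then the map sending the canonical member x of each
  -- pair {x, -x} to x² and the other one to -1 - x² is injective, hence surjective; but
  -- -1 is not one of its values.
  private module _ (no-solution : ∀ x y → ¬ (x * x + y * y + 1# ≈ 0#)) where
    x*x≉-1-y*y : ∀ x y → ¬ (x * x ≈ - 1# - y * y)
    x*x≉-1-y*y x y xx≈-1-yy = no-solution x y (begin
      x * x + y * y + 1#                ≈⟨ +-congʳ (+-congʳ xx≈-1-yy) ⟩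
      (- 1# - y * y) + y * y + 1#       ≈⟨ solve 1 (λ y → (:- con (+ 1) :- y :* y) :+ y :* y :+ con (+ 1) := con (+ 0))
                                             refl y ⟩
      0#                                ∎)

    -1-x*x≈-1-y*y⇒x*x≈y*y : ∀ {x y} → - 1# - x * x ≈ - 1# - y * y → x * x ≈ y * y
    -1-x*x≈-1-y*y⇒x*x≈y*y {x} {y} eq = begin
      x * x                   ≈⟨ solve 1 (λ x → x :* x := :- con (+ 1) :- (:- con (+ 1) :- x :* x)) refl x ⟩
      - 1# - (- 1# - x * x)   ≈⟨ +-congˡ (-‿cong eq) ⟩
      - 1# - (- 1# - y * y)   ≈⟨ solve 1 (λ y → :- con (+ 1) :- (:- con (+ 1) :- y :* y) := y :* y) refl y ⟩
      y * y                   ∎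

    data FoldSpec (x : Carrier) : Carrier → Set c where
      canonical : Canonical x → FoldSpec x (x * x)
      non-canonical : ¬ Canonical x → FoldSpec x (- 1# - x * x)

    fold : Carrier → Carrier
    fold x with index x Fin.≤? index (- x)
    ... | yes _ = x * x
    ... | no _ = - 1# - x * x

    fold-spec : ∀ x → FoldSpec x (fold x)
    fold-spec x with index x Fin.≤? index (- x)
    ... | yes x-canonical = canonical x-canonical
    ... | no x-non-canonical = non-canonical x-non-canonical

    fold-cong : ∀ {x y} → x ≈ y → fold x ≈ fold y
    fold-cong {x} {y} x≈y = go (fold-spec x) (fold-spec y)
      where
      go : ∀ {u v} → FoldSpec x u → FoldSpec y v → u ≈ v
      go (canonical _) (canonical _) = *-cong x≈y x≈y
      go (canonical cx) (non-canonical ¬cy) = ⊥-elim (¬cy (canonical-cong x≈y cx))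
      go (non-canonical ¬cx) (canonical cy) = ⊥-elim (¬cx (canonical-cong (sym x≈y) cy))
      go (non-canonical _) (non-canonical _) = +-congˡ (-‿cong (*-cong x≈y x≈y))

    fold-injective : ∀ {x y} → fold x ≈ fold y → x ≈ y
    fold-injective {x} {y} = go (fold-spec x) (fold-spec y)
      where
      go : ∀ {u v} → FoldSpec x u → FoldSpec y v → u ≈ v → x ≈ y
      go (canonical cx) (canonical cy) xx≈yy = [ id , (λ x≈-y → canonical-± x≈-y cx cy) ]′ (x*x≈y*y⇒x≈±y xx≈yy)
      go (canonical _) (non-canonical _) eq = ⊥-elim (x*x≉-1-y*y x y eq)
      go (non-canonical _) (canonical _) eq = ⊥-elim (x*x≉-1-y*y y x (sym eq))
      go (non-canonical ¬cx) (non-canonical ¬cy) eq =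
        [ id , (λ x≈-y → ⊥-elim ([ ¬cx , ¬cy ]′ (canonical-∓ x≈-y))) ]′ (x*x≈y*y⇒x≈±y (-1-x*x≈-1-y*y⇒x*x≈y*y eq))

    fold≉-1 : ∀ x → ¬ (fold x ≈ - 1#)
    fold≉-1 x = go (fold-spec x)
      where
      go : ∀ {u} → FoldSpec x u → ¬ (u ≈ - 1#)
      go (canonical _) xx≈-1 =
        x*x≉-1-y*y x 0# (trans xx≈-1 (solve 0 (:- con (+ 1) := :- con (+ 1) :- con (+ 0) :* con (+ 0)) refl))
      go (non-canonical ¬cx) -1-xx≈-1 = ¬cx (canonical-cong (sym x≈0) canonical-0)
        where
        x≈0 : x ≈ 0#
        x≈0 = x*x≈0⇒x≈0 (begin
          x * x                   ≈⟨ solve 1 (λ x → x :* x := :- con (+ 1) :- (:- con (+ 1) :- x :* x)) refl x ⟩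
          - 1# - (- 1# - x * x)   ≈⟨ +-congˡ (-‿cong -1-xx≈-1) ⟩
          - 1# - - 1#             ≈⟨ -‿inverseʳ (- 1#) ⟩
          0#                      ∎)

    absurd : ⊥
    absurd = let x , fold-x≈-1 = injective⇒surjective R-enumeration R-enumeration fold fold-cong fold-injective (- 1#)
             in fold≉-1 x fold-x≈-1

  ∃-sum-of-two-squares≈-1 : ∃[ x ] ∃[ y ] (x * x + y * y + 1# ≈ 0#)
  ∃-sum-of-two-squares≈-1 with any? (λ x≈x′ (y , eq) → y , trans (+-congʳ (+-congʳ (*-cong (sym x≈x′) (sym x≈x′)))) eq)
                                    (λ x → any? (λ y≈y′ eq → trans (+-congʳ (+-congˡ (*-cong (sym y≈y′) (sym y≈y′)))) eq)
                                                (λ y → (x * x + y * y + 1#) ≟ 0#))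
  ... | yes solution = solution
  ... | no none = ⊥-elim (absurd (λ x y eq → none (x , y , eq)))

  1+1≈0⇒square-surjective : 1# + 1# ≈ 0# → ∀ y → ∃[ x ] (x * x ≈ y)
  1+1≈0⇒square-surjective 1+1≈0 =
    injective⇒surjective R-enumeration R-enumeration (λ x → x * x) (λ x≈y → *-cong x≈y x≈y) square-injective
    where
    square-injective : ∀ {x y} → x * x ≈ y * y → x ≈ y
    square-injective {x} {y} xx≈yy = x-y≈0⇒x≈y (x*x≈0⇒x≈0 (begin
      (x - y) * (x - y)
        ≈⟨ solve 2 (λ x y → (x :- y) :* (x :- y) := (x :* x :- y :* y) :+ (con (+ 1) :+ con (+ 1)) :* (y :* y :- x :* y))
             refl x y ⟩
      (x * x - y * y) + (1# + 1#) * (y * y - x * y)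
        ≈⟨ +-cong (x≈y⇒x-y≈0 xx≈yy) (trans (*-congʳ 1+1≈0) (zeroˡ _)) ⟩
      0# + 0#
        ≈⟨ +-identityʳ 0# ⟩
      0# ∎))

module Formulas {c ℓ} (R : RawRing c ℓ) where
  open RawRing R

  infixl 7 _·_
  infixl 6 _⊕_ _⊖_ _-_

  _-_ : Carrier → Carrier → Carrier
  x - y = x + - y

  Vector : Set c
  Vector = Carrier × Carrier × Carrier

  _·_ : Carrier → Vector → Vector
  s · (x₀ , x₁ , x₂) = s * x₀ , s * x₁ , s * x₂

  _⊕_ : Vector → Vector → Vector
  (x₀ , x₁ , x₂) ⊕ (y₀ , y₁ , y₂) = x₀ + y₀ , x₁ + y₁ , x₂ + y₂

  _⊖_ : Vector → Vector → Vector
  (x₀ , x₁ , x₂) ⊖ (y₀ , y₁ , y₂) = x₀ - y₀ , x₁ - y₁ , x₂ - y₂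

  dot : Vector → Vector → Carrier
  dot (x₀ , x₁ , x₂) (y₀ , y₁ , y₂) = x₀ * y₀ + x₁ * y₁ + x₂ * y₂

  evalAt : Carrier → Vector → Carrier
  evalAt x (a₀ , a₁ , a₂) = a₀ + a₁ * x + a₂ * (x * x)

  productLow : Vector → Vector → Vector
  productLow (a₀ , a₁ , a₂) (b₀ , b₁ , b₂) = a₀ * b₀ , a₀ * b₁ + a₁ * b₀ , a₀ * b₂ + a₁ * b₁ + a₂ * b₀

  productX³ productX⁴ : Vector → Vector → Carrier
  productX³ (a₀ , a₁ , a₂) (b₀ , b₁ , b₂) = a₁ * b₂ + a₂ * b₁
  productX⁴ (a₀ , a₁ , a₂) (b₀ , b₁ , b₂) = a₂ * b₂

  -- The X²-coefficient of a product, once X³ and X⁴ are reduced to vectors whose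
  -- X²-coefficients are c and d.
  form : Carrier → Carrier → Vector → Vector → Carrier
  form c d x y = proj₂ (proj₂ (productLow x y)) + c * productX³ x y + d * productX⁴ x y

  two : Carrier
  two = 1# + 1#

  -- Orthogonal bases of form c d whose vectors all have norm -4 when a² + b² + 1 = 0, and
  -- norm 1 when d = t² and 2 = 0.
  odd-u₁ odd-u₂ odd-u₃ : Carrier → Carrier → Carrier → Carrier → Vector
  odd-u₁ a b c d = - (two * a * c) - b * (d - 1#) , two * a , two * b
  odd-u₂ a b c d = two * b * c - a * (d - 1#) , - (two * b) , two * a
  odd-u₃ a b c d = - (d + 1#) , 0# , two

  even-u₁ even-u₂ even-u₃ : Carrier → Carrier → Vector
  even-u₁ t c = - c + t + 1# , 1# , 0#
  even-u₂ t c = - ((1# + t) * c) , 1# + t , 1#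
  even-u₃ t c = 1# - (1# + t) * c , 1# + t , 1#

module Coordinates {c ℓ} (K : CommutativeRing c ℓ) where
  open CommutativeRing K
  open IntegerCoefficients K
  open Formulas rawRing public hiding (_-_)
  private module P {n} = Formulas (Polynomial-rawRing n)
  open import Relation.Binary.Reasoning.Setoid setoid

  Vector-setoid : Setoid c ℓ
  Vector-setoid = setoid ×ₛ (setoid ×ₛ setoid)

  infix 4 _≈³_
  _≈³_ : Vector → Vector → Set ℓ
  _≈³_ = Setoid._≈_ Vector-setoid

  evalAt-cong : ∀ x {u v} → u ≈³ v → evalAt x u ≈ evalAt x v
  evalAt-cong x (u₀≈v₀ , u₁≈v₁ , u₂≈v₂) = +-cong (+-cong u₀≈v₀ (*-congʳ u₁≈v₁)) (*-congʳ u₂≈v₂)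

  evalAt-⊕ : ∀ x u v → evalAt x (u ⊕ v) ≈ evalAt x u + evalAt x v
  evalAt-⊕ x (u₀ , u₁ , u₂) (v₀ , v₁ , v₂) = solve 7 (λ x u₀ u₁ u₂ v₀ v₁ v₂ →
    P.evalAt x ((u₀ , u₁ , u₂) P.⊕ (v₀ , v₁ , v₂)) := P.evalAt x (u₀ , u₁ , u₂) :+ P.evalAt x (v₀ , v₁ , v₂))
    refl x u₀ u₁ u₂ v₀ v₁ v₂

  evalAt-⊖ : ∀ x u v → evalAt x (u ⊖ v) ≈ evalAt x u - evalAt x v
  evalAt-⊖ x (u₀ , u₁ , u₂) (v₀ , v₁ , v₂) = solve 7 (λ x u₀ u₁ u₂ v₀ v₁ v₂ →
    P.evalAt x ((u₀ , u₁ , u₂) P.⊖ (v₀ , v₁ , v₂)) := P.evalAt x (u₀ , u₁ , u₂) :- P.evalAt x (v₀ , v₁ , v₂))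
    refl x u₀ u₁ u₂ v₀ v₁ v₂

  evalAt-· : ∀ x s u → evalAt x (s · u) ≈ s * evalAt x u
  evalAt-· x s (u₀ , u₁ , u₂) = solve 5 (λ x s u₀ u₁ u₂ →
    P.evalAt x (s P.· (u₀ , u₁ , u₂)) := s :* P.evalAt x (u₀ , u₁ , u₂)) refl x s u₀ u₁ u₂

  evalAt-* : ∀ x u v → evalAt x u * evalAt x v ≈
    evalAt x (productLow u v) + productX³ u v * (x * (x * x)) + productX⁴ u v * (x * (x * (x * x)))
  evalAt-* x (u₀ , u₁ , u₂) (v₀ , v₁ , v₂) = solve 7 (λ x u₀ u₁ u₂ v₀ v₁ v₂ → let u = u₀ , u₁ , u₂ ; v = v₀ , v₁ , v₂ in
    P.evalAt x u :* P.evalAt x v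
      := P.evalAt x (P.productLow u v) :+ P.productX³ u v :* (x :* (x :* x)) :+ P.productX⁴ u v :* (x :* (x :* (x :* x))))
    refl x u₀ u₁ u₂ v₀ v₁ v₂

  record IsSymmetricBilinear (B : Vector → Vector → Carrier) : Set (c ⊔ ℓ) where
    field
      congˡ : ∀ {x y} z → x ≈³ y → B x z ≈ B y z
      symmetric : ∀ x y → B x y ≈ B y x
      additiveˡ : ∀ x y z → B (x ⊕ y) z ≈ B x z + B y z
      homogeneousˡ : ∀ s x z → B (s · x) z ≈ s * B x z

  form-isSymmetricBilinear : ∀ c d → IsSymmetricBilinear (form c d)
  form-isSymmetricBilinear c d = record
    { congˡ = λ _ (x₀≈y₀ , x₁≈y₁ , x₂≈y₂) →
        +-cong (+-cong (+-cong (+-cong (*-congʳ x₀≈y₀) (*-congʳ x₁≈y₁)) (*-congʳ x₂≈y₂))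
          (*-congˡ (+-cong (*-congʳ x₁≈y₁) (*-congʳ x₂≈y₂)))) (*-congˡ (*-congʳ x₂≈y₂))
    ; symmetric = λ (x₀ , x₁ , x₂) (y₀ , y₁ , y₂) →
        solve 8 (λ c d x₀ x₁ x₂ y₀ y₁ y₂ → let x = x₀ , x₁ , x₂ ; y = y₀ , y₁ , y₂ in
          P.form c d x y := P.form c d y x) refl c d x₀ x₁ x₂ y₀ y₁ y₂
    ; additiveˡ = λ (x₀ , x₁ , x₂) (y₀ , y₁ , y₂) (z₀ , z₁ , z₂) →
        solve 11 (λ c d x₀ x₁ x₂ y₀ y₁ y₂ z₀ z₁ z₂ → let x = x₀ , x₁ , x₂ ; y = y₀ , y₁ , y₂ ; z = z₀ , z₁ , z₂ in
          P.form c d (x P.⊕ y) z := P.form c d x z :+ P.form c d y z) refl c d x₀ x₁ x₂ y₀ y₁ y₂ z₀ z₁ z₂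
    ; homogeneousˡ = λ s (x₀ , x₁ , x₂) (z₀ , z₁ , z₂) →
        solve 9 (λ c d s x₀ x₁ x₂ z₀ z₁ z₂ → let x = x₀ , x₁ , x₂ ; z = z₀ , z₁ , z₂ in
          P.form c d (s P.· x) z := s :* P.form c d x z) refl c d s x₀ x₁ x₂ z₀ z₁ z₂
    }

  form-cong-last-coefficient : ∀ {c d d′} → d ≈ d′ → ∀ x y → form c d x y ≈ form c d′ x y
  form-cong-last-coefficient d≈d′ (x₀ , x₁ , x₂) (y₀ , y₁ , y₂) = +-congˡ (*-congʳ d≈d′)

  record OrthogonalBasis (B : Vector → Vector → Carrier) : Set (c ⊔ ℓ) where
    field
      u₁ u₂ u₃ : Vector
      norm : Carrier
      norm≉0 : ¬ (norm ≈ 0#)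
      B[u₁,u₁]≈norm : B u₁ u₁ ≈ norm
      B[u₂,u₂]≈norm : B u₂ u₂ ≈ norm
      B[u₃,u₃]≈norm : B u₃ u₃ ≈ norm
      B[u₁,u₂]≈0 : B u₁ u₂ ≈ 0#
      B[u₁,u₃]≈0 : B u₁ u₃ ≈ 0#
      B[u₂,u₃]≈0 : B u₂ u₃ ≈ 0#

  OrthogonalBasis-transport : ∀ {B B′} → (∀ x y → B x y ≈ B′ x y) → OrthogonalBasis B → OrthogonalBasis B′
  OrthogonalBasis-transport B≈B′ basis = record
    { u₁ = u₁ ; u₂ = u₂ ; u₃ = u₃ ; norm = norm ; norm≉0 = norm≉0
    ; B[u₁,u₁]≈norm = trans (sym (B≈B′ u₁ u₁)) B[u₁,u₁]≈norm
    ; B[u₂,u₂]≈norm = trans (sym (B≈B′ u₂ u₂)) B[u₂,u₂]≈norm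
    ; B[u₃,u₃]≈norm = trans (sym (B≈B′ u₃ u₃)) B[u₃,u₃]≈norm
    ; B[u₁,u₂]≈0 = trans (sym (B≈B′ u₁ u₂)) B[u₁,u₂]≈0
    ; B[u₁,u₃]≈0 = trans (sym (B≈B′ u₁ u₃)) B[u₁,u₃]≈0
    ; B[u₂,u₃]≈0 = trans (sym (B≈B′ u₂ u₃)) B[u₂,u₃]≈0
    }
    where open OrthogonalBasis basis

  ≈-modulo : ∀ {r x δ m} → r ≈ 0# → x ≈ δ + r * m → x ≈ δ
  ≈-modulo {r} {x} {δ} {m} r≈0 x≈δ+rm = begin
    x           ≈⟨ x≈δ+rm ⟩
    δ + r * m   ≈⟨ +-congˡ (trans (*-congʳ r≈0) (zeroˡ m)) ⟩
    δ + 0#      ≈⟨ +-identityʳ δ ⟩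
    δ           ∎

module FiniteFieldForms {c ℓ} (K : CommutativeRing c ℓ) (K-field : IsField K) {q : ℕ}
    (K-enumeration : Enumeration (CommutativeRing.setoid K) q) where
  open CommutativeRing K
  open IsField K-field
  open IntegerCoefficients K
  open Coordinates K
  open FiniteField K K-field K-enumeration
  private module P {n} = Formulas (Polynomial-rawRing n)
  open import Relation.Binary.Reasoning.Setoid setoid

  module _ {a b : Carrier} (c d : Carrier) (a²+b²+1≈0 : a * a + b * b + 1# ≈ 0#) (two≉0 : ¬ (two ≈ 0#)) where
    open import Algebra.Properties.Ring ring using (-‿involutive; -0#≈0#)

    odd-orthogonalBasis : OrthogonalBasis (form c d)
    odd-orthogonalBasis = record
      { u₁ = odd-u₁ a b c d ; u₂ = odd-u₂ a b c d ; u₃ = odd-u₃ a b c d ; norm = - (two * two)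
      ; norm≉0 = λ -4≈0 → x≉0∧y≉0⇒x*y≉0 two≉0 two≉0 (trans (sym (-‿involutive _)) (trans (-‿cong -4≈0) -0#≈0#))
      ; B[u₁,u₁]≈norm = ≈-modulo a²+b²+1≈0 (solve 4 (λ a b c d →
          P.form c d (P.odd-u₁ a b c d) (P.odd-u₁ a b c d)
            := :- (P.two :* P.two) :+ (a :* a :+ b :* b :+ con (+ 1)) :* (P.two :* P.two)) refl a b c d)
      ; B[u₂,u₂]≈norm = ≈-modulo a²+b²+1≈0 (solve 4 (λ a b c d →
          P.form c d (P.odd-u₂ a b c d) (P.odd-u₂ a b c d)
            := :- (P.two :* P.two) :+ (a :* a :+ b :* b :+ con (+ 1)) :* (P.two :* P.two)) refl a b c d)
      ; B[u₃,u₃]≈norm = solve 4 (λ a b c d →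
          P.form c d (P.odd-u₃ a b c d) (P.odd-u₃ a b c d) := :- (P.two :* P.two)) refl a b c d
      ; B[u₁,u₂]≈0 = solve 4 (λ a b c d → P.form c d (P.odd-u₁ a b c d) (P.odd-u₂ a b c d) := con (+ 0)) refl a b c d
      ; B[u₁,u₃]≈0 = solve 4 (λ a b c d → P.form c d (P.odd-u₁ a b c d) (P.odd-u₃ a b c d) := con (+ 0)) refl a b c d
      ; B[u₂,u₃]≈0 = solve 4 (λ a b c d → P.form c d (P.odd-u₂ a b c d) (P.odd-u₃ a b c d) := con (+ 0)) refl a b c d
      }

  module _ (t c : Carrier) (two≈0 : two ≈ 0#) where
    even-orthogonalBasis : OrthogonalBasis (form c (t * t))
    even-orthogonalBasis = record
      { u₁ = even-u₁ t c ; u₂ = even-u₂ t c ; u₃ = even-u₃ t c ; norm = 1#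
      ; norm≉0 = λ 1≈0 → 0≉1 (sym 1≈0)
      ; B[u₁,u₁]≈norm = solve 2 (λ t c →
          P.form c (t :* t) (P.even-u₁ t c) (P.even-u₁ t c) := con (+ 1)) refl t c
      ; B[u₂,u₂]≈norm = ≈-modulo two≈0 (solve 2 (λ t c →
          P.form c (t :* t) (P.even-u₂ t c) (P.even-u₂ t c) := con (+ 1) :+ P.two :* (t :+ t :* t)) refl t c)
      ; B[u₃,u₃]≈norm = ≈-modulo two≈0 (solve 2 (λ t c →
          P.form c (t :* t) (P.even-u₃ t c) (P.even-u₃ t c) := con (+ 1) :+ P.two :* (con (+ 1) :+ t :+ t :* t)) refl t c)
      ; B[u₁,u₂]≈0 = ≈-modulo two≈0 (solve 2 (λ t c →
          P.form c (t :* t) (P.even-u₁ t c) (P.even-u₂ t c) := con (+ 0) :+ P.two :* (con (+ 1) :+ t)) refl t c)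
      ; B[u₁,u₃]≈0 = ≈-modulo two≈0 (solve 2 (λ t c →
          P.form c (t :* t) (P.even-u₁ t c) (P.even-u₃ t c) := con (+ 0) :+ P.two :* (con (+ 1) :+ t)) refl t c)
      ; B[u₂,u₃]≈0 = ≈-modulo two≈0 (solve 2 (λ t c →
          P.form c (t :* t) (P.even-u₂ t c) (P.even-u₃ t c) := con (+ 0) :+ P.two :* (con (+ 1) :+ t :+ t :* t)) refl t c)
      }

  -- Opaque, like the other definitions below that choose witnesses by exhaustive search:
  -- the type checker would otherwise try to evaluate the search.
  opaque
    orthogonalBasis : ∀ c d → OrthogonalBasis (form c d)
    orthogonalBasis c d = by-characteristic (two ≟ 0#)
      where
      by-characteristic : Dec (two ≈ 0#) → OrthogonalBasis (form c d)
      by-characteristic (no two≉0) = odd-orthogonalBasis c d (proj₂ (proj₂ ∃-sum-of-two-squares≈-1)) two≉0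
      by-characteristic (yes two≈0) = OrthogonalBasis-transport (form-cong-last-coefficient (proj₂ √d))
                                        (even-orthogonalBasis (proj₁ √d) c two≈0)
        where
        √d : ∃[ t ] (t * t ≈ d)
        √d = 1+1≈0⇒square-surjective two≈0 d

  module Isometry {B : Vector → Vector → Carrier} (B-bilinear : IsSymmetricBilinear B) (basis : OrthogonalBasis B) where
    open IsSymmetricBilinear B-bilinear
    open OrthogonalBasis basis

    fromBasis : Vector → Vector
    fromBasis (w₀ , w₁ , w₂) = w₀ · u₁ ⊕ (w₁ · u₂ ⊕ w₂ · u₃)

    private
      weighted-cong : ∀ w₀ w₁ w₂ {x₀ x₁ x₂ y₀ y₁ y₂} → x₀ ≈ y₀ → x₁ ≈ y₁ → x₂ ≈ y₂ →
                      w₀ * x₀ + (w₁ * x₁ + w₂ * x₂) ≈ w₀ * y₀ + (w₁ * y₁ + w₂ * y₂)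
      weighted-cong w₀ w₁ w₂ x₀≈y₀ x₁≈y₁ x₂≈y₂ = +-cong (*-congˡ x₀≈y₀) (+-cong (*-congˡ x₁≈y₁) (*-congˡ x₂≈y₂))

      B[u₂,u₁]≈0 : B u₂ u₁ ≈ 0#
      B[u₂,u₁]≈0 = trans (symmetric u₂ u₁) B[u₁,u₂]≈0

      B[u₃,u₁]≈0 : B u₃ u₁ ≈ 0#
      B[u₃,u₁]≈0 = trans (symmetric u₃ u₁) B[u₁,u₃]≈0

      B[u₃,u₂]≈0 : B u₃ u₂ ≈ 0#
      B[u₃,u₂]≈0 = trans (symmetric u₃ u₂) B[u₂,u₃]≈0

    B-fromBasisˡ : ∀ w₀ w₁ w₂ z → B (fromBasis (w₀ , w₁ , w₂)) z ≈ w₀ * B u₁ z + (w₁ * B u₂ z + w₂ * B u₃ z)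
    B-fromBasisˡ w₀ w₁ w₂ z = begin
      B (w₀ · u₁ ⊕ (w₁ · u₂ ⊕ w₂ · u₃)) z             ≈⟨ additiveˡ _ _ z ⟩
      B (w₀ · u₁) z + B (w₁ · u₂ ⊕ w₂ · u₃) z         ≈⟨ +-congˡ (additiveˡ _ _ z) ⟩
      B (w₀ · u₁) z + (B (w₁ · u₂) z + B (w₂ · u₃) z) ≈⟨ +-cong (homogeneousˡ w₀ u₁ z)
                                                           (+-cong (homogeneousˡ w₁ u₂ z) (homogeneousˡ w₂ u₃ z)) ⟩
      w₀ * B u₁ z + (w₁ * B u₂ z + w₂ * B u₃ z)       ∎

    B-fromBasis-u₁ : ∀ w₀ w₁ w₂ → B (fromBasis (w₀ , w₁ , w₂)) u₁ ≈ norm * w₀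
    B-fromBasis-u₁ w₀ w₁ w₂ = begin
      B (fromBasis (w₀ , w₁ , w₂)) u₁                 ≈⟨ B-fromBasisˡ w₀ w₁ w₂ u₁ ⟩
      w₀ * B u₁ u₁ + (w₁ * B u₂ u₁ + w₂ * B u₃ u₁)  ≈⟨ weighted-cong w₀ w₁ w₂ B[u₁,u₁]≈norm B[u₂,u₁]≈0 B[u₃,u₁]≈0 ⟩
      w₀ * norm + (w₁ * 0# + w₂ * 0#)               ≈⟨ solve 4 (λ k w₀ w₁ w₂ →
                                                          w₀ :* k :+ (w₁ :* con (+ 0) :+ w₂ :* con (+ 0)) := k :* w₀)
                                                          refl norm w₀ w₁ w₂ ⟩
      norm * w₀                                     ∎

    B-fromBasis-u₂ : ∀ w₀ w₁ w₂ → B (fromBasis (w₀ , w₁ , w₂)) u₂ ≈ norm * w₁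
    B-fromBasis-u₂ w₀ w₁ w₂ = begin
      B (fromBasis (w₀ , w₁ , w₂)) u₂                 ≈⟨ B-fromBasisˡ w₀ w₁ w₂ u₂ ⟩
      w₀ * B u₁ u₂ + (w₁ * B u₂ u₂ + w₂ * B u₃ u₂)  ≈⟨ weighted-cong w₀ w₁ w₂ B[u₁,u₂]≈0 B[u₂,u₂]≈norm B[u₃,u₂]≈0 ⟩
      w₀ * 0# + (w₁ * norm + w₂ * 0#)               ≈⟨ solve 4 (λ k w₀ w₁ w₂ →
                                                          w₀ :* con (+ 0) :+ (w₁ :* k :+ w₂ :* con (+ 0)) := k :* w₁)
                                                          refl norm w₀ w₁ w₂ ⟩
      norm * w₁                                     ∎

    B-fromBasis-u₃ : ∀ w₀ w₁ w₂ → B (fromBasis (w₀ , w₁ , w₂)) u₃ ≈ norm * w₂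
    B-fromBasis-u₃ w₀ w₁ w₂ = begin
      B (fromBasis (w₀ , w₁ , w₂)) u₃                 ≈⟨ B-fromBasisˡ w₀ w₁ w₂ u₃ ⟩
      w₀ * B u₁ u₃ + (w₁ * B u₂ u₃ + w₂ * B u₃ u₃)  ≈⟨ weighted-cong w₀ w₁ w₂ B[u₁,u₃]≈0 B[u₂,u₃]≈0 B[u₃,u₃]≈norm ⟩
      w₀ * 0# + (w₁ * 0# + w₂ * norm)               ≈⟨ solve 4 (λ k w₀ w₁ w₂ →
                                                          w₀ :* con (+ 0) :+ (w₁ :* con (+ 0) :+ w₂ :* k) := k :* w₂)
                                                          refl norm w₀ w₁ w₂ ⟩
      norm * w₂                                     ∎

    B-fromBasis : ∀ w w′ → B (fromBasis w) (fromBasis w′) ≈ norm * dot w w′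
    B-fromBasis w@(w₀ , w₁ , w₂) w′@(w′₀ , w′₁ , w′₂) = begin
      B (fromBasis w) (fromBasis w′)
        ≈⟨ symmetric _ _ ⟩
      B (fromBasis w′) (fromBasis w)
        ≈⟨ B-fromBasisˡ w′₀ w′₁ w′₂ (fromBasis w) ⟩
      w′₀ * B u₁ (fromBasis w) + (w′₁ * B u₂ (fromBasis w) + w′₂ * B u₃ (fromBasis w))
        ≈⟨ weighted-cong w′₀ w′₁ w′₂ (trans (symmetric _ _) (B-fromBasis-u₁ w₀ w₁ w₂))
             (trans (symmetric _ _) (B-fromBasis-u₂ w₀ w₁ w₂)) (trans (symmetric _ _) (B-fromBasis-u₃ w₀ w₁ w₂)) ⟩
      w′₀ * (norm * w₀) + (w′₁ * (norm * w₁) + w′₂ * (norm * w₂))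
        ≈⟨ solve 7 (λ k w₀ w₁ w₂ w′₀ w′₁ w′₂ → w′₀ :* (k :* w₀) :+ (w′₁ :* (k :* w₁) :+ w′₂ :* (k :* w₂))
                     := k :* P.dot (w₀ , w₁ , w₂) (w′₀ , w′₁ , w′₂)) refl norm w₀ w₁ w₂ w′₀ w′₁ w′₂ ⟩
      norm * dot w w′
        ∎

    fromBasis-cong : ∀ {w w′} → w ≈³ w′ → fromBasis w ≈³ fromBasis w′
    fromBasis-cong {w₀ , w₁ , w₂} {w′₀ , w′₁ , w′₂} (w₀≈w′₀ , w₁≈w′₁ , w₂≈w′₂) = combination , combination , combination
      where
      combination : ∀ {x y z} → w₀ * x + (w₁ * y + w₂ * z) ≈ w′₀ * x + (w′₁ * y + w′₂ * z)
      combination = +-cong (*-congʳ w₀≈w′₀) (+-cong (*-congʳ w₁≈w′₁) (*-congʳ w₂≈w′₂))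

    fromBasis-injective : ∀ {w w′} → fromBasis w ≈³ fromBasis w′ → w ≈³ w′
    fromBasis-injective {w₀ , w₁ , w₂} {w′₀ , w′₁ , w′₂} eq =
        *-cancelˡ norm≉0 (trans (sym (B-fromBasis-u₁ w₀ w₁ w₂)) (trans (congˡ u₁ eq) (B-fromBasis-u₁ w′₀ w′₁ w′₂)))
      , *-cancelˡ norm≉0 (trans (sym (B-fromBasis-u₂ w₀ w₁ w₂)) (trans (congˡ u₂ eq) (B-fromBasis-u₂ w′₀ w′₁ w′₂)))
      , *-cancelˡ norm≉0 (trans (sym (B-fromBasis-u₃ w₀ w₁ w₂)) (trans (congˡ u₃ eq) (B-fromBasis-u₃ w′₀ w′₁ w′₂)))

    fromBasis-homogeneous : ∀ s w → fromBasis (s · w) ≈³ s · fromBasis w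
    fromBasis-homogeneous s (w₀ , w₁ , w₂) =
        coordinate (proj₁ u₁) (proj₁ u₂) (proj₁ u₃)
      , coordinate (proj₁ (proj₂ u₁)) (proj₁ (proj₂ u₂)) (proj₁ (proj₂ u₃))
      , coordinate (proj₂ (proj₂ u₁)) (proj₂ (proj₂ u₂)) (proj₂ (proj₂ u₃))
      where
      coordinate : ∀ x y z → s * w₀ * x + (s * w₁ * y + s * w₂ * z) ≈ s * (w₀ * x + (w₁ * y + w₂ * z))
      coordinate = solve 7 (λ s w₀ w₁ w₂ x y z →
        s :* w₀ :* x :+ (s :* w₁ :* y :+ s :* w₂ :* z) := s :* (w₀ :* x :+ (w₁ :* y :+ w₂ :* z))) refl s w₀ w₁ w₂

module FieldEmbeddingProperties {c₁ ℓ₁ c₂ ℓ₂} {K : CommutativeRing c₁ ℓ₁} {F : CommutativeRing c₂ ℓ₂}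
    (K-field : IsField K) (F-field : IsField F) {ι : CommutativeRing.Carrier K → CommutativeRing.Carrier F}
    (ι-embedding : IsFieldEmbedding K F ι) where
  private
    module K = CommutativeRing K
    module F = CommutativeRing F
  open IsFieldEmbedding ι-embedding
  open import Algebra.Properties.Group F.+-group using (identityˡ-unique; inverseˡ-unique)
  open import Relation.Binary.Reasoning.Setoid F.setoid

  ι-0 : ι K.0# F.≈ F.0#
  ι-0 = identityˡ-unique (ι K.0#) (ι K.0#) (F.trans (F.sym (ι-+ K.0# K.0#)) (ι-cong (K.+-identityˡ K.0#)))

  ι-‿ : ∀ a → ι (K.- a) F.≈ F.- ι a
  ι-‿ a = inverseˡ-unique (ι (K.- a)) (ι a) (F.trans (F.sym (ι-+ (K.- a) a)) (F.trans (ι-cong (K.-‿inverseˡ a)) ι-0))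

  ι-≈0 : ∀ {a} → a K.≈ K.0# → ι a F.≈ F.0#
  ι-≈0 a≈0 = F.trans (ι-cong a≈0) ι-0

  ι-inverse : ∀ {a b} → a K.* b K.≈ K.1# → ι (b K.* a) F.≈ F.1#
  ι-inverse ab≈1 = F.trans (ι-cong (K.trans (K.*-comm _ _) ab≈1)) ι-1

  ι-nonzero : ∀ {a} → ¬ (a K.≈ K.0#) → ¬ (ι a F.≈ F.0#)
  ι-nonzero {a} a≉0 ιa≈0 with a⁻¹ , aa⁻¹≈1 ← IsField.inverse K-field a a≉0 = IsField.0≉1 F-field (begin
    F.0#               ≈⟨ F.zeroˡ (ι a⁻¹) ⟨
    F.0# F.* ι a⁻¹     ≈⟨ F.*-congʳ ιa≈0 ⟨
    ι a F.* ι a⁻¹      ≈⟨ ι-* a a⁻¹ ⟨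
    ι (a K.* a⁻¹)      ≈⟨ ι-cong aa⁻¹≈1 ⟩
    ι K.1#             ≈⟨ ι-1 ⟩
    F.1#               ∎)

module CubicExtension {c₁ ℓ₁ c₂ ℓ₂} {q : ℕ}
    {K : CommutativeRing c₁ ℓ₁} (K-field : IsField K) (K-enumeration : Enumeration (CommutativeRing.setoid K) q)
    {F : CommutativeRing c₂ ℓ₂} (F-field : IsField F) (F-enumeration : Enumeration (CommutativeRing.setoid F) (q ^ 3))
    {ι : CommutativeRing.Carrier K → CommutativeRing.Carrier F} (ι-embedding : IsFieldEmbedding K F ι)
    {ξ : CommutativeRing.Carrier F} (ξ-primitive : IsPrimitive F ξ) where
  private
    module K where
      open CommutativeRing K public
      open IsField K-field public
      open FiniteField K K-field K-enumeration public
      open IntegerCoefficients K public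
      open Enumeration K-enumeration public using (≉⇒2≤)
    module F where
      open CommutativeRing F public
      open FiniteField F F-field F-enumeration public
      open IntegerCoefficients F public
    module F³ = Coordinates F
  open Coordinates K
  open IntegerCoefficients F using (_:+_; _:*_; _:-_; :-_; con; _:=_)
  open IsFieldEmbedding ι-embedding
  open FieldEmbeddingProperties K-field F-field ι-embedding
  open Construction K F ι ξ using (InS)
  open import Relation.Binary.Reasoning.Setoid F.setoid

  ξ³ ξ⁴ : F.Carrier
  ξ³ = ξ F.* (ξ F.* ξ)
  ξ⁴ = ξ F.* ξ³

  ι³ : Vector → F³.Vector
  ι³ (a₀ , a₁ , a₂) = ι a₀ , ι a₁ , ι a₂

  eval : Vector → F.Carrier
  eval v = F³.evalAt ξ (ι³ v)

  ι-*+* : ∀ a b c d → ι (a K.* b K.+ c K.* d) F.≈ ι a F.* ι b F.+ ι c F.* ι d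
  ι-*+* a b c d = F.trans (ι-+ _ _) (F.+-cong (ι-* a b) (ι-* c d))

  ι³-productLow : ∀ v w → ι³ (productLow v w) F³.≈³ F³.productLow (ι³ v) (ι³ w)
  ι³-productLow (v₀ , v₁ , v₂) (w₀ , w₁ , w₂) =
    ι-* v₀ w₀ , ι-*+* v₀ w₁ v₁ w₀ , F.trans (ι-+ _ _) (F.+-cong (ι-*+* v₀ w₂ v₁ w₁) (ι-* v₂ w₀))

  eval-cong : ∀ {v w} → v ≈³ w → eval v F.≈ eval w
  eval-cong (v₀≈w₀ , v₁≈w₁ , v₂≈w₂) = F³.evalAt-cong ξ (ι-cong v₀≈w₀ , ι-cong v₁≈w₁ , ι-cong v₂≈w₂)

  eval-⊕ : ∀ v w → eval (v ⊕ w) F.≈ eval v F.+ eval w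
  eval-⊕ v@(v₀ , v₁ , v₂) w@(w₀ , w₁ , w₂) =
    F.trans (F³.evalAt-cong ξ (ι-+ v₀ w₀ , ι-+ v₁ w₁ , ι-+ v₂ w₂)) (F³.evalAt-⊕ ξ (ι³ v) (ι³ w))

  eval-⊖ : ∀ v w → eval (v ⊖ w) F.≈ eval v F.- eval w
  eval-⊖ v@(v₀ , v₁ , v₂) w@(w₀ , w₁ , w₂) =
    F.trans (F³.evalAt-cong ξ (ι-- v₀ w₀ , ι-- v₁ w₁ , ι-- v₂ w₂)) (F³.evalAt-⊖ ξ (ι³ v) (ι³ w))
    where
    ι-- : ∀ a b → ι (a K.- b) F.≈ ι a F.- ι b
    ι-- a b = F.trans (ι-+ a (K.- b)) (F.+-congˡ (ι-‿ b))

  eval-· : ∀ s v → eval (s · v) F.≈ ι s F.* eval v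
  eval-· s v@(v₀ , v₁ , v₂) = F.trans (F³.evalAt-cong ξ (ι-* s v₀ , ι-* s v₁ , ι-* s v₂)) (F³.evalAt-· ξ (ι s) (ι³ v))

  eval-* : ∀ v w → eval v F.* eval w F.≈
    eval (productLow v w) F.+ ι (productX³ v w) F.* ξ³ F.+ ι (productX⁴ v w) F.* ξ⁴
  eval-* v@(v₀ , v₁ , v₂) w@(w₀ , w₁ , w₂) = F.trans (F³.evalAt-* ξ (ι³ v) (ι³ w))
    (F.sym (F.+-cong (F.+-cong (F³.evalAt-cong ξ (ι³-productLow v w)) (F.*-congʳ (ι-*+* v₁ w₂ v₂ w₁)))
                     (F.*-congʳ (ι-* v₂ w₂))))

  InSpan : F.Carrier → Set (c₁ ⊔ ℓ₂)
  InSpan x = ∃[ a ] ∃[ b ] (ι a F.+ ι b F.* ξ F.≈ x)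

  0∈span : InSpan F.0#
  0∈span = K.0# , K.0# , F.trans (F.+-cong ι-0 (F.trans (F.*-congʳ ι-0) (F.zeroˡ ξ))) (F.+-identityˡ F.0#)

  1∈span : InSpan F.1#
  1∈span = K.1# , K.0# , F.trans (F.+-cong ι-1 (F.trans (F.*-congʳ ι-0) (F.zeroˡ ξ))) (F.+-identityʳ F.1#)

  ξ²∈span⇒ξ*-preserves-span : InSpan (ξ F.* ξ) → ∀ {x} → InSpan x → InSpan (ξ F.* x)
  ξ²∈span⇒ξ*-preserves-span (a₂ , b₂ , a₂+b₂ξ≈ξ²) {x} (a , b , a+bξ≈x) = b K.* a₂ , a K.+ b K.* b₂ , (begin
    ι (b K.* a₂) F.+ ι (a K.+ b K.* b₂) F.* ξ
      ≈⟨ F.+-cong (ι-* b a₂) (F.*-congʳ (F.trans (ι-+ a _) (F.+-congˡ (ι-* b b₂)))) ⟩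
    ι b F.* ι a₂ F.+ (ι a F.+ ι b F.* ι b₂) F.* ξ
      ≈⟨ F.solve 5 (λ a b a₂ b₂ ξ → b :* a₂ :+ (a :+ b :* b₂) :* ξ := ξ :* (a :+ b :* ξ) :+ b :* (a₂ :+ b₂ :* ξ :- ξ :* ξ))
           F.refl (ι a) (ι b) (ι a₂) (ι b₂) ξ ⟩
    ξ F.* (ι a F.+ ι b F.* ξ) F.+ ι b F.* (ι a₂ F.+ ι b₂ F.* ξ F.- ξ F.* ξ)
      ≈⟨ F.+-cong (F.*-congˡ a+bξ≈x) (F.*-congˡ (F.x≈y⇒x-y≈0 a₂+b₂ξ≈ξ²)) ⟩
    ξ F.* x F.+ ι b F.* F.0#
      ≈⟨ F.trans (F.+-congˡ (F.zeroʳ (ι b))) (F.+-identityʳ _) ⟩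
    ξ F.* x
      ∎)

  ξ²∈span⇒powers∈span : InSpan (ξ F.* ξ) → ∀ n → InSpan (pow F ξ n)
  ξ²∈span⇒powers∈span ξ²∈span zero = 1∈span
  ξ²∈span⇒powers∈span ξ²∈span (suc n) = ξ²∈span⇒ξ*-preserves-span ξ²∈span (ξ²∈span⇒powers∈span ξ²∈span n)

  ξ²∈span⇒everything∈span : InSpan (ξ F.* ξ) → ∀ x → InSpan x
  ξ²∈span⇒everything∈span ξ²∈span x with x F.≟ F.0#
  ... | yes x≈0 = let a , b , eq = 0∈span in a , b , F.trans eq (F.sym x≈0)
  ... | no x≉0 = let n , ξⁿ≈x = proj₂ ξ-primitive x x≉0
                     a , b , eq = ξ²∈span⇒powers∈span ξ²∈span n
                 in a , b , F.trans eq ξⁿ≈x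

  q*q<q^3 : q ℕ.* q ℕ.< q ^ 3
  q*q<q^3 = ≡.subst (ℕ._< q ^ 3) (≡.cong (q ℕ.*_) (ℕₚ.*-identityʳ q)) (ℕₚ.^-monoʳ-< q (K.≉⇒2≤ K.0≉1) (ℕₚ.n<1+n 2))

  -- Otherwise the span of 1 and ξ would be closed under multiplication by the generator ξ,
  -- hence all of F, but it has at most q² < q³ elements.
  ξ²∉span : ¬ InSpan (ξ F.* ξ)
  ξ²∉span ξ²∈span = ℕₚ.<⇒≱ q*q<q^3 (surjective⇒≤ (K-enumeration ×-enumeration K-enumeration) F-enumeration
    (λ (a , b) → ι a F.+ ι b F.* ξ)
    (λ (a≈a′ , b≈b′) → F.+-cong (ι-cong a≈a′) (F.*-congʳ (ι-cong b≈b′)))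
    (λ x → let a , b , eq = ξ²∈span⇒everything∈span ξ²∈span x in (a , b) , eq))

  monic-relation⇒ξ²∈span : ∀ a b → F³.evalAt ξ (ι a , ι b , F.1#) F.≈ F.0# → InSpan (ξ F.* ξ)
  monic-relation⇒ξ²∈span a b relation = K.- a , K.- b , (begin
    ι (K.- a) F.+ ι (K.- b) F.* ξ
      ≈⟨ F.+-cong (ι-‿ a) (F.*-congʳ (ι-‿ b)) ⟩
    F.- ι a F.+ F.- ι b F.* ξ
      ≈⟨ F.solve 3 (λ a b ξ → :- a :+ :- b :* ξ := ξ :* ξ :- (a :+ b :* ξ :+ con (+ 1) :* (ξ :* ξ))) F.refl (ι a) (ι b) ξ ⟩
    ξ F.* ξ F.- F³.evalAt ξ (ι a , ι b , F.1#)
      ≈⟨ F.+-congˡ (F.-‿cong relation) ⟩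
    ξ F.* ξ F.- F.0#
      ≈⟨ F.solve 1 (λ x → x :- con (+ 0) := x) F.refl (ξ F.* ξ) ⟩
    ξ F.* ξ
      ∎)

  linear-relation⇒ξ²∈span : ∀ a → F³.evalAt ξ (ι a , F.1# , F.0#) F.≈ F.0# → InSpan (ξ F.* ξ)
  linear-relation⇒ξ²∈span a relation = K.0# , K.- a , (begin
    ι K.0# F.+ ι (K.- a) F.* ξ
      ≈⟨ F.+-cong ι-0 (F.*-congʳ (ι-‿ a)) ⟩
    F.0# F.+ F.- ι a F.* ξ
      ≈⟨ F.solve 2 (λ a ξ → con (+ 0) :+ :- a :* ξ := ξ :* ξ :- ξ :* (a :+ con (+ 1) :* ξ :+ con (+ 0) :* (ξ :* ξ)))
           F.refl (ι a) ξ ⟩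
    ξ F.* ξ F.- ξ F.* F³.evalAt ξ (ι a , F.1# , F.0#)
      ≈⟨ F.+-congˡ (F.-‿cong (F.*-congˡ relation)) ⟩
    ξ F.* ξ F.- ξ F.* F.0#
      ≈⟨ F.solve 1 (λ x → x :* x :- x :* con (+ 0) := x :* x) F.refl ξ ⟩
    ξ F.* ξ
      ∎)

  eval-·-≈0 : ∀ s {v} → eval v F.≈ F.0# → eval (s · v) F.≈ F.0#
  eval-·-≈0 s {v} eval≈0 = F.trans (eval-· s v) (F.trans (F.*-congˡ eval≈0) (F.zeroʳ (ι s)))

  eval≈0⇒≈0 : ∀ {v} → eval v F.≈ F.0# → v ≈³ (K.0# , K.0# , K.0#)
  eval≈0⇒≈0 {α , β , γ} eval≈0 with γ K.≟ K.0# | β K.≟ K.0# | α K.≟ K.0#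
  ... | no γ≉0 | _ | _ with g , γg≈1 ← K.inverse γ γ≉0 =
    ⊥-elim (ξ²∉span (monic-relation⇒ξ²∈span (g K.* α) (g K.* β)
      (F.trans (F³.evalAt-cong ξ (F.refl , F.refl , F.sym (ι-inverse γg≈1))) (eval-·-≈0 g eval≈0))))
  ... | yes γ≈0 | no β≉0 | _ with g , βg≈1 ← K.inverse β β≉0 =
    ⊥-elim (ξ²∉span (linear-relation⇒ξ²∈span (g K.* α)
      (F.trans (F³.evalAt-cong ξ (F.refl , F.sym (ι-inverse βg≈1) , F.sym (ι-≈0 (K.trans (K.*-congˡ γ≈0) (K.zeroʳ g)))))
               (eval-·-≈0 g eval≈0))))
  ... | yes γ≈0 | yes β≈0 | no α≉0 = ⊥-elim (ι-nonzero α≉0 (begin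
    ι α
      ≈⟨ F.solve 2 (λ a ξ → a := a :+ con (+ 0) :* ξ :+ con (+ 0) :* (ξ :* ξ)) F.refl (ι α) ξ ⟩
    F³.evalAt ξ (ι α , F.0# , F.0#)
      ≈⟨ F³.evalAt-cong ξ (F.refl , F.sym (ι-≈0 β≈0) , F.sym (ι-≈0 γ≈0)) ⟩
    eval (α , β , γ)
      ≈⟨ eval≈0 ⟩
    F.0# ∎))
  ... | yes γ≈0 | yes β≈0 | yes α≈0 = α≈0 , β≈0 , γ≈0

  eval-injective : ∀ {v w} → eval v F.≈ eval w → v ≈³ w
  eval-injective {v} {w} eval-v≈eval-w = ⊖≈0⇒≈ (eval≈0⇒≈0 (F.trans (eval-⊖ v w) (F.x≈y⇒x-y≈0 eval-v≈eval-w)))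
    where
    ⊖≈0⇒≈ : ∀ {v w} → v ⊖ w ≈³ (K.0# , K.0# , K.0#) → v ≈³ w
    ⊖≈0⇒≈ (v₀-w₀≈0 , v₁-w₁≈0 , v₂-w₂≈0) = K.x-y≈0⇒x≈y v₀-w₀≈0 , K.x-y≈0⇒x≈y v₁-w₁≈0 , K.x-y≈0⇒x≈y v₂-w₂≈0

  K³-enumeration : Enumeration Vector-setoid (q ^ 3)
  K³-enumeration = ≡.subst (Enumeration Vector-setoid) (≡.cong (λ m → q ℕ.* (q ℕ.* m)) (≡.sym (ℕₚ.*-identityʳ q)))
    (K-enumeration ×-enumeration (K-enumeration ×-enumeration K-enumeration))

  opaque
    eval-surjective : ∀ x → ∃[ v ] (eval v F.≈ x)
    eval-surjective = injective⇒surjective K³-enumeration F-enumeration eval eval-cong eval-injective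

  coefficients : F.Carrier → Vector
  coefficients x = proj₁ (eval-surjective x)

  eval-coefficients : ∀ x → eval (coefficients x) F.≈ x
  eval-coefficients x = proj₂ (eval-surjective x)

  coefficients-unique : ∀ {v x} → eval v F.≈ x → coefficients x ≈³ v
  coefficients-unique {v} {x} eval-v≈x = eval-injective (F.trans (eval-coefficients x) (F.sym eval-v≈x))

  coefficient₂ : F.Carrier → K.Carrier
  coefficient₂ x = proj₂ (proj₂ (coefficients x))

  coefficient₂-unique : ∀ {v x} → eval v F.≈ x → coefficient₂ x K.≈ proj₂ (proj₂ v)
  coefficient₂-unique eval-v≈x = proj₂ (proj₂ (coefficients-unique eval-v≈x))

  coefficient₂-cong : ∀ {x y} → x F.≈ y → coefficient₂ x K.≈ coefficient₂ y
  coefficient₂-cong {x} x≈y = K.sym (coefficient₂-unique (F.trans (eval-coefficients x) x≈y))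

  c₃ c₄ : K.Carrier
  c₃ = coefficient₂ ξ³
  c₄ = coefficient₂ ξ⁴

  coefficient₂-eval-* : ∀ v w → coefficient₂ (eval v F.* eval w) K.≈ form c₃ c₄ v w
  coefficient₂-eval-* v w = K.trans (coefficient₂-unique eval-u≈vw)
    (K.solve 5 (λ l m₃ m₄ c₃ c₄ → l K.:+ (m₃ K.:* c₃ K.:+ m₄ K.:* c₄) K.:= l K.:+ c₃ K.:* m₃ K.:+ c₄ K.:* m₄) K.refl
      (proj₂ (proj₂ (productLow v w))) (productX³ v w) (productX⁴ v w) c₃ c₄)
    where
    u : Vector
    u = productLow v w ⊕ (productX³ v w · coefficients ξ³ ⊕ productX⁴ v w · coefficients ξ⁴)

    eval-u≈vw : eval u F.≈ eval v F.* eval w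
    eval-u≈vw = begin
      eval u
        ≈⟨ F.trans (eval-⊕ _ _) (F.+-congˡ (eval-⊕ _ _)) ⟩
      eval (productLow v w) F.+ (eval (productX³ v w · coefficients _) F.+ eval (productX⁴ v w · coefficients _))
        ≈⟨ F.+-congˡ (F.+-cong (F.trans (eval-· _ _) (F.*-congˡ (eval-coefficients _)))
                               (F.trans (eval-· _ _) (F.*-congˡ (eval-coefficients _)))) ⟩
      eval (productLow v w) F.+ (ι (productX³ v w) F.* ξ³ F.+ ι (productX⁴ v w) F.* ξ⁴)
        ≈⟨ F.+-assoc _ _ _ ⟨
      eval (productLow v w) F.+ ι (productX³ v w) F.* ξ³ F.+ ι (productX⁴ v w) F.* ξ⁴
        ≈⟨ eval-* v w ⟨
      eval v F.* eval w
        ∎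

  InS⇒coefficient₂≈0 : ∀ {x} → InS x → coefficient₂ x K.≈ K.0#
  InS⇒coefficient₂≈0 {x} (inj₁ (t , x≈tξ)) = coefficient₂-unique {v = K.0# , t , K.0#} (begin
    eval (K.0# , t , K.0#)
      ≈⟨ F³.evalAt-cong ξ (ι-0 , F.refl , ι-0) ⟩
    F³.evalAt ξ (F.0# , ι t , F.0#)
      ≈⟨ F.solve 2 (λ t ξ → con (+ 0) :+ t :* ξ :+ con (+ 0) :* (ξ :* ξ) := t :* ξ) F.refl (ι t) ξ ⟩
    ι t F.* ξ
      ≈⟨ x≈tξ ⟨
    x ∎)
  InS⇒coefficient₂≈0 {x} (inj₂ (t , u , x≈u[1+tξ])) = coefficient₂-unique {v = u , u K.* t , K.0#} (begin
    eval (u , u K.* t , K.0#)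
      ≈⟨ F³.evalAt-cong ξ (F.refl , ι-* u t , ι-0) ⟩
    F³.evalAt ξ (ι u , ι u F.* ι t , F.0#)
      ≈⟨ F.solve 3 (λ u t ξ → u :+ u :* t :* ξ :+ con (+ 0) :* (ξ :* ξ) := u :* (con (+ 1) :+ t :* ξ))
           F.refl (ι u) (ι t) ξ ⟩
    ι u F.* (F.1# F.+ ι t F.* ξ)
      ≈⟨ x≈u[1+tξ] ⟨
    x ∎)

  InSpan⇒InS : ∀ {x} → InSpan x → InS x
  InSpan⇒InS {x} (a , b , a+bξ≈x) with a K.≟ K.0#
  ... | yes a≈0 = inj₁ (b , F.trans (F.sym a+bξ≈x) (F.trans (F.+-congʳ (ι-≈0 a≈0)) (F.+-identityˡ _)))
  ... | no a≉0 with a⁻¹ , aa⁻¹≈1 ← K.inverse a a≉0 = inj₂ (a⁻¹ K.* b , a , F.sym (begin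
    ι a F.* (F.1# F.+ ι (a⁻¹ K.* b) F.* ξ)
      ≈⟨ F.*-congˡ (F.+-congˡ (F.*-congʳ (ι-* a⁻¹ b))) ⟩
    ι a F.* (F.1# F.+ ι a⁻¹ F.* ι b F.* ξ)
      ≈⟨ F.solve 4 (λ a a⁻¹ b ξ → a :* (con (+ 1) :+ a⁻¹ :* b :* ξ) := a :+ (a⁻¹ :* a) :* b :* ξ)
           F.refl (ι a) (ι a⁻¹) (ι b) ξ ⟩
    ι a F.+ (ι a⁻¹ F.* ι a) F.* ι b F.* ξ
      ≈⟨ F.+-congˡ (F.*-congʳ (F.*-congʳ (F.trans (F.sym (ι-* a⁻¹ a)) (ι-inverse aa⁻¹≈1)))) ⟩
    ι a F.+ F.1# F.* ι b F.* ξ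
      ≈⟨ F.+-congˡ (F.*-congʳ (F.*-identityˡ (ι b))) ⟩
    ι a F.+ ι b F.* ξ
      ≈⟨ a+bξ≈x ⟩
    x ∎))

  coefficient₂≈0⇒InS : ∀ {x} → coefficient₂ x K.≈ K.0# → InS x
  coefficient₂≈0⇒InS {x} c≈0 = InSpan⇒InS (a , b , (begin
    ι a F.+ ι b F.* ξ
      ≈⟨ F.solve 3 (λ a b ξ → a :+ b :* ξ := a :+ b :* ξ :+ con (+ 0) :* (ξ :* ξ)) F.refl (ι a) (ι b) ξ ⟩
    F³.evalAt ξ (ι a , ι b , F.0#)
      ≈⟨ F³.evalAt-cong ξ (F.refl , F.refl , F.sym (ι-≈0 c≈0)) ⟩
    eval (coefficients x)
      ≈⟨ eval-coefficients x ⟩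
    x ∎))
    where
    a b : K.Carrier
    a = proj₁ (coefficients x)
    b = proj₁ (proj₂ (coefficients x))

module DifferenceGraphIsomorphism {c₁ ℓ₁ c₂ ℓ₂} {q : ℕ}
    {K : CommutativeRing c₁ ℓ₁} (K-field : IsField K) (K-enumeration : Enumeration (CommutativeRing.setoid K) q)
    {F : CommutativeRing c₂ ℓ₂} (F-field : IsField F) (F-enumeration : Enumeration (CommutativeRing.setoid F) (q ^ 3))
    {ι : CommutativeRing.Carrier K → CommutativeRing.Carrier F} (ι-embedding : IsFieldEmbedding K F ι)
    {ξ : CommutativeRing.Carrier F} (ξ-primitive : IsPrimitive F ξ) where
  private
    module K where
      open CommutativeRing K public
      open FiniteField K K-field K-enumeration public
    module F = CommutativeRing F
  open Coordinates K
  open FiniteFieldForms K K-field K-enumeration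
  open CubicExtension K-field K-enumeration F-field F-enumeration ι-embedding ξ-primitive
  open Isometry (form-isSymmetricBilinear c₃ c₄) (orthogonalBasis c₃ c₄)
  open OrthogonalBasis (orthogonalBasis c₃ c₄) using (norm; norm≉0)
  open FieldEmbeddingProperties K-field F-field ι-embedding using (ι-0)
  open Construction K F ι ξ using (GVert; _~G_; DiffAdj; PVert; _~P_; BrownAdj; InS)
  open import Function.Bundles using (_⇔_; mk⇔; module Equivalence)
  open import Function.Related.TypeIsomorphisms using (¬-cong-⇔)
  open import Data.Product.Function.NonDependent.Propositional using (_×-⇔_)
  open import Relation.Binary.Reasoning.Setoid F.setoid

  ψ : Vector → F.Carrier
  ψ w = eval (fromBasis w)

  ψ-cong : ∀ {w w′} → w ≈³ w′ → ψ w F.≈ ψ w′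
  ψ-cong w≈w′ = eval-cong (fromBasis-cong w≈w′)

  ψ-injective : ∀ {w w′} → ψ w F.≈ ψ w′ → w ≈³ w′
  ψ-injective ψw≈ψw′ = fromBasis-injective (eval-injective ψw≈ψw′)

  ψ-· : ∀ s w → ψ (s · w) F.≈ ι s F.* ψ w
  ψ-· s w = F.trans (eval-cong (fromBasis-homogeneous s w)) (eval-· s (fromBasis w))

  ψ-0 : ψ (K.0# , K.0# , K.0#) F.≈ F.0#
  ψ-0 = begin
    ψ (K.0# , K.0# , K.0#)              ≈⟨ ψ-cong (K.sym (K.zeroˡ K.0#) , K.sym (K.zeroˡ K.0#) , K.sym (K.zeroˡ K.0#)) ⟩
    ψ (K.0# · (K.0# , K.0# , K.0#))     ≈⟨ ψ-· K.0# _ ⟩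
    ι K.0# F.* ψ (K.0# , K.0# , K.0#)   ≈⟨ F.trans (F.*-congʳ ι-0) (F.zeroˡ _) ⟩
    F.0#                                ∎

  coefficient₂-ψ-* : ∀ w w′ → coefficient₂ (ψ w F.* ψ w′) K.≈ norm K.* dot w w′
  coefficient₂-ψ-* w w′ = K.trans (coefficient₂-eval-* (fromBasis w) (fromBasis w′)) (B-fromBasis w w′)

  opaque
    ψ-surjective : ∀ x → ∃[ w ] (ψ w F.≈ x)
    ψ-surjective = injective⇒surjective K³-enumeration F-enumeration ψ ψ-cong ψ-injective

  ψ⁻¹ : F.Carrier → Vector
  ψ⁻¹ x = proj₁ (ψ-surjective x)

  ψ-ψ⁻¹ : ∀ x → ψ (ψ⁻¹ x) F.≈ x
  ψ-ψ⁻¹ x = proj₂ (ψ-surjective x)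

  φ : GVert → PVert
  φ (x , x≉0) = ψ⁻¹ x , λ ψ⁻¹x≈0 → x≉0 (F.trans (F.sym (ψ-ψ⁻¹ x)) (F.trans (ψ-cong ψ⁻¹x≈0) ψ-0))

  ~G⇔~P : ∀ x y → (x ~G y) ⇔ (φ x ~P φ y)
  ~G⇔~P (x , _) (y , _) = mk⇔
    (λ (t , y≈tx) → t , ψ-injective (begin
      ψ (ψ⁻¹ y)            ≈⟨ ψ-ψ⁻¹ y ⟩
      y                    ≈⟨ y≈tx ⟩
      ι t F.* x            ≈⟨ F.*-congˡ (ψ-ψ⁻¹ x) ⟨
      ι t F.* ψ (ψ⁻¹ x)    ≈⟨ ψ-· t (ψ⁻¹ x) ⟨
      ψ (t · ψ⁻¹ x)        ∎))
    (λ (t , ψ⁻¹y≈tψ⁻¹x) → t , (begin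
      y                    ≈⟨ ψ-ψ⁻¹ y ⟨
      ψ (ψ⁻¹ y)            ≈⟨ ψ-cong ψ⁻¹y≈tψ⁻¹x ⟩
      ψ (t · ψ⁻¹ x)        ≈⟨ ψ-· t (ψ⁻¹ x) ⟩
      ι t F.* ψ (ψ⁻¹ x)    ≈⟨ F.*-congˡ (ψ-ψ⁻¹ x) ⟩
      ι t F.* x            ∎))

  InS⇔dot≈0 : ∀ x y → InS (x F.* y) ⇔ (dot (ψ⁻¹ x) (ψ⁻¹ y) K.≈ K.0#)
  InS⇔dot≈0 x y = mk⇔
    (λ xy∈S → K.*-cancelˡ norm≉0 (K.trans (K.sym coefficient₂[xy]≈norm*dot)
                                          (K.trans (InS⇒coefficient₂≈0 xy∈S) (K.sym (K.zeroʳ norm)))))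
    (λ dot≈0 → coefficient₂≈0⇒InS (K.trans coefficient₂[xy]≈norm*dot (K.trans (K.*-congˡ dot≈0) (K.zeroʳ norm))))
    where
    coefficient₂[xy]≈norm*dot : coefficient₂ (x F.* y) K.≈ norm K.* dot (ψ⁻¹ x) (ψ⁻¹ y)
    coefficient₂[xy]≈norm*dot = K.trans (coefficient₂-cong (F.*-cong (F.sym (ψ-ψ⁻¹ x)) (F.sym (ψ-ψ⁻¹ y))))
                                        (coefficient₂-ψ-* (ψ⁻¹ x) (ψ⁻¹ y))

  ≈⇒≈1· : ∀ {v w} → v ≈³ w → w ≈³ K.1# · v
  ≈⇒≈1· (v₀≈w₀ , v₁≈w₁ , v₂≈w₂) =
      K.sym (K.trans (K.*-identityˡ _) v₀≈w₀)
    , K.sym (K.trans (K.*-identityˡ _) v₁≈w₁)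
    , K.sym (K.trans (K.*-identityˡ _) v₂≈w₂)

  isomorphism : QuotGraphIso GVert _~G_ DiffAdj PVert _~P_ BrownAdj
  isomorphism = record
    { φ = φ
    ; φ-cong = λ {x} {y} → Equivalence.to (~G⇔~P x y)
    ; φ-injective = λ {x} {y} → Equivalence.from (~G⇔~P x y)
    ; φ-surjective = λ (w , w≉0) → (ψ w , λ ψw≈0 → w≉0 (ψ-injective (F.trans ψw≈0 (F.sym ψ-0))))
                                 , K.1# , ≈⇒≈1· (ψ-injective (ψ-ψ⁻¹ (ψ w)))
    ; φ-adj = λ x@(x′ , _) y@(y′ , _) → ¬-cong-⇔ (~G⇔~P x y) ×-⇔ InS⇔dot≈0 x′ y′
    }

hasCardinality⇒enumeration : ∀ {c ℓ n} (R : CommutativeRing c ℓ) → HasCardinality R n →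
                             Enumeration (CommutativeRing.setoid R) n
hasCardinality⇒enumeration R R-cardinality = record
  { enum = enum ; enum-injective = enum-injective _ _ ; enum-surjective = enum-surjective }
  where open HasCardinality R-cardinality

theorem4 : {c₁ ℓ₁ c₂ ℓ₂ : Level} (q : ℕ) → IsPrimePower q →
    (K : CommutativeRing c₁ ℓ₁) → IsField K → HasCardinality K q →
    (F : CommutativeRing c₂ ℓ₂) → IsField F → HasCardinality F (q ^ 3) →
    (ι : CommutativeRing.Carrier K → CommutativeRing.Carrier F) → IsFieldEmbedding K F ι →
    (ξ : CommutativeRing.Carrier F) → IsPrimitive F ξ →
    let open Construction K F ι ξ in
    QuotGraphIso GVert _~G_ DiffAdj PVert _~P_ BrownAdj
theorem4 q _ K K-field K-cardinality F F-field F-cardinality ι ι-embedding ξ ξ-primitive =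
  DifferenceGraphIsomorphism.isomorphism K-field (hasCardinality⇒enumeration K K-cardinality)
    F-field (hasCardinality⇒enumeration F F-cardinality) ι-embedding ξ-primitive
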